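{- Let $D$ be a continuous dcpo with a basis $B$. Suppose that at least one of the following conditions holds: (i) for all $a,b\in B$, $\neg\neg(a\ll b)$ implies $a\ll b$; (ii) for all $a,b\in B$, $\neg\neg(a\sqsubseteq b)$ implies $a\sqsubseteq b$; (iii) for all $a,b\in B$ it is decidable whether $a\ll b$; (iv) for all $a,b\in B$ it is decidable whether $a\sqsubseteq b$. Then $\{\twoheaduparrow b \mid b\in B\}$, where $\twoheaduparrow b=\{y\in D\mid b\ll y\}$, is a $\neg\neg$-stable basis for the Scott topology on $D$. Consequently, the Scott topology on $D$ coincides with the apartness topology on $D$ with respect to the intrinsic apartness: a subset of $D$ is Scott open if and only if it is nearly open.
   Context: We work constructively: informal set theory without excluded middle or choice axioms. A subset $S$ of a poset is directed if it is inhabited and any two elements of $S$ have an upper bound in $S$. A dcpo is a poset in which every directed subset $S$ has a supremum $\bigsqcup S$. In a dcpo $D$, $x\ll y$ ($x$ is way below $y$) if for every directed $S\subseteq D$ with $y\sqsubseteq\bigsqcup S$ there is $s\in S$ with $x\sqsubseteq s$. A basis of $D$ is a subset $B\subseteq D$ such that for every $x\in D$ the set $\{b\in B\mid b\ll x\}$ is directed with supremum $x$; $D$ is continuous if it has a basis. A subset $U\subseteq D$ is Scott open if it is an upper set and whenever $S$ is directed with $\bigsqcup S\in U$ then some $s\in S$ lies in $U$. A proposition $P$ is decidable if $P\vee\neg P$. For $x,y\in D$ write $x\not\leq_{\mathrm S} y$ if there is a Scott open set containing $x$ but not $y$. The intrinsic apartness is the relation $x\# y$ iff ($x\not\leq_{\mathrm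 S}y$ or $y\not\leq_{\mathrm S}x$). For a subset $A$ of a topological space $X$ with a binary relation $\#$, the logical complement is $\neg A=\{x\in X\mid x\notin A\}$ and the complement is ${\sim}A=\{x\in X\mid \forall y\in A,\ x\# y\}$; $Y^\circ$ denotes the interior of $Y$. The apartness complement of $A$ is $-A=\{x\in X\mid x\in({\sim}A)^\circ\}$; subsets of this form are called nearly open, and the apartness topology on $X$ is the topology having the nearly open subsets as basic opens. A basis $\mathcal B$ of opens of $X$ is $\neg\neg$-stable if $U=(\neg\neg U)^\circ$ for every $U\in\mathcal B$. -}

module Defs where

-- Conventions:
--   * the dcpo has carrier in Set and order in Set;
--   * "directed subsets" (those the dcpo has suprema for, and that appear in
--     the definitions of way-below and of Scott open) are predicates
--     Carrier → Set;
--   * the subsets forming the Scott topology (opens, the basic opens ↟b,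
--     the subsets A in -A) are predicates Carrier → Set₁, since ↟b is
--     defined via the (large) way-below relation.

open import Level using (Level)
open import Data.Product using (Σ; _×_; _,_)
open import Data.Sum using (_⊎_)
open import Relation.Nullary using (¬_)
open import Relation.Binary.PropositionalEquality using (_≡_)

_↔_ : ∀ {a b} → Set a → Set b → Set _
A ↔ B = (A → B) × (B → A)

Decidable : ∀ {a} → Set a → Set a
Decidable P = P ⊎ ¬ P

record Poset : Set₁ where
  field
    Carrier   : Set
    _⊑_       : Carrier → Carrier → Set
    ⊑-refl    : ∀ {x} → x ⊑ x
    ⊑-trans   : ∀ {x y z} → x ⊑ y → y ⊑ z → x ⊑ z
    ⊑-antisym : ∀ {x y} → x ⊑ y → y ⊑ x → x ≡ y

module PosetNotions (P : Poset) where
  open Poset P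

  IsDirected : ∀ {ℓ} → (Carrier → Set ℓ) → Set ℓ
  IsDirected S =
    Σ Carrier S ×
    (∀ x y → S x → S y → Σ Carrier (λ z → S z × (x ⊑ z × y ⊑ z)))

  IsUpperBound : ∀ {ℓ} → (Carrier → Set ℓ) → Carrier → Set ℓ
  IsUpperBound S u = ∀ x → S x → x ⊑ u

  IsSup : ∀ {ℓ} → (Carrier → Set ℓ) → Carrier → Set ℓ
  IsSup S s = IsUpperBound S s × (∀ u → IsUpperBound S u → s ⊑ u)

open PosetNotions public

record DCPO : Set₁ where
  field
    poset : Poset
  open Poset poset public
  field
    ∐       : (S : Carrier → Set) → IsDirected poset S → Carrier
    ∐-isSup : (S : Carrier → Set) (d : IsDirected poset S) → IsSup poset S (∐ S d)

module _ (D : DCPO) where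
  open DCPO D

  _≪_ : Carrier → Carrier → Set₁
  x ≪ y = (S : Carrier → Set) (d : IsDirected poset S) →
          y ⊑ ∐ S d → Σ Carrier (λ s → S s × x ⊑ s)

  IsBasis : (Carrier → Set) → Set₁
  IsBasis B = ∀ x → IsDirected poset (λ b → B b × b ≪ x)
                  × IsSup poset (λ b → B b × b ≪ x) x

  -- (predicativity side condition)
  -- b ≪ x is equivalent to a small proposition for b ∈ B
  WayBelowSmallOnBasis : (Carrier → Set) → Set₁
  WayBelowSmallOnBasis B = ∀ b x → B b → Σ Set (λ P → P ↔ (b ≪ x))

  IsScottOpen : ∀ {ℓ} → (Carrier → Set ℓ) → Set _
  IsScottOpen U =
    (∀ x y → x ⊑ y → U x → U y) ×
    ((S : Carrier → Set) (d : IsDirected poset S) →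
       U (∐ S d) → Σ Carrier (λ s → S s × U s))

  ↟ : Carrier → Carrier → Set₁
  ↟ b y = b ≪ y

  interior : ∀ {ℓ} → (Carrier → Set ℓ) → Carrier → Set _
  interior Y x = Σ (Carrier → Set₁)
    (λ V → IsScottOpen V × (V x × (∀ z → V z → Y z)))

  _≰S_ : Carrier → Carrier → Set₂
  x ≰S y = Σ (Carrier → Set₁) (λ U → IsScottOpen U × (U x × ¬ U y))

  _#_ : Carrier → Carrier → Set₂
  x # y = (x ≰S y) ⊎ (y ≰S x)

  ∼ : (Carrier → Set₁) → Carrier → Set₂
  ∼ A x = ∀ y → A y → x # y

  -- apartness complement  -A = (∼A)°
  apartComp : (Carrier → Set₁) → Carrier → Set₂
  apartComp A = interior (∼ A)

  IsNearlyOpen : ∀ {ℓ} → (Carrier → Set ℓ) → Set _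
  IsNearlyOpen N = Σ (Carrier → Set₁) (λ A → ∀ x → N x ↔ apartComp A x)

  -- open in the apartness topology (the topology with the nearly open
  -- subsets as basic opens): every point of U lies in a nearly open
  -- subset contained in U
  IsApartnessOpen : (Carrier → Set₁) → Set₂
  IsApartnessOpen U = ∀ x → U x →
    Σ (Carrier → Set₁) (λ A → apartComp A x × (∀ z → apartComp A z → U z))

  IsScottTopologyBasis : {I : Set} → (I → Carrier → Set₁) → Set₂
  IsScottTopologyBasis {I} W =
    (∀ i → IsScottOpen (W i)) ×
    ((U : Carrier → Set₁) → IsScottOpen U →
       ∀ x → U x → Σ I (λ i → W i x × (∀ z → W i z → U z)))

  IsNotNotStableFamily : {I : Set} → (I → Carrier → Set₁) → Set₂
  IsNotNotStableFamily {I} W =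
    ∀ i x → W i x ↔ interior (λ y → ¬ ¬ W i y) x

  IsNotNotStableScottBasis : {I : Set} → (I → Carrier → Set₁) → Set₂
  IsNotNotStableScottBasis W = IsScottTopologyBasis W × IsNotNotStableFamily W

{-# OPTIONS --safe #-}
-- Interpolation, which holds in every continuous dcpo, makes each ↟ b Scott
-- open, and a Scott open U ∋ x contains some basis element b ≪ x, because x is
-- the directed supremum of its basis approximants; so the ↟ b form a basis.
-- Each of the four conditions gives ¬¬ (b ≪ c) → b ⊑ c on B, and hence
-- ¬¬-stability: a Scott neighbourhood of x inside ¬¬ ↟ b contains some c ≪ x
-- in B, so b ⊑ c ≪ x. Finally a ¬¬-stable open V is nearly open, V = -(¬ V):
-- V itself separates its points from ¬ V, and ∼(¬ V) ⊆ ¬¬ V because # is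
-- irreflexive. Conversely every nearly open set is an interior, hence open.
module Submission where

open import Defs
open import Data.Product using (Σ; Σ-syntax; _×_; _,_; proj₁; proj₂)
open import Data.Sum using (_⊎_; inj₁; inj₂; [_,_])
open import Function using (_∘_)
open import Relation.Nullary using (¬_)
open import Relation.Nullary.Negation using (Stable; ¬¬-map; contradiction)
open import Relation.Unary using (∁; _⊆′_; _≐′_)
open import Relation.Binary.PropositionalEquality using (_≡_; refl)

module PosetProperties (P : Poset) where
  open Poset P

  isDirected-resp-≐′ : ∀ {ℓ ℓ′} {S : Carrier → Set ℓ} {T : Carrier → Set ℓ′} →
    S ≐′ T → IsDirected P S → IsDirected P T
  isDirected-resp-≐′ (S⊆T , T⊆S) ((s , Ss) , join) =
    (s , S⊆T s Ss) ,
    λ x y Tx Ty →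
      let (z , Sz , x⊑z , y⊑z) = join x y (T⊆S x Tx) (T⊆S y Ty)
      in z , S⊆T z Sz , x⊑z , y⊑z

  ⋃-directed : {I : Carrier → Set} {S : Carrier → Carrier → Set} →
    IsDirected P I → (∀ c → I c → IsDirected P (S c)) →
    (∀ {c c′} → c ⊑ c′ → S c ⊆′ S c′) →
    IsDirected P (λ a → Σ[ c ∈ Carrier ] I c × S c a)
  ⋃-directed {I} {S} ((c , Ic) , I-join) S-directed S-mono =
    (let (a , Sca) = proj₁ (S-directed c Ic) in a , c , Ic , Sca) ,
    join
    where
    join : ∀ a a′ → Σ[ c ∈ Carrier ] I c × S c a → Σ[ c ∈ Carrier ] I c × S c a′ →
      Σ[ z ∈ Carrier ] (Σ[ c ∈ Carrier ] I c × S c z) × a ⊑ z × a′ ⊑ z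
    join a a′ (c , Ic , Sca) (c′ , Ic′ , Sc′a′) =
      let (e , Ie , c⊑e , c′⊑e) = I-join c c′ Ic Ic′
          (z , Sez , a⊑z , a′⊑z) =
            proj₂ (S-directed e Ie) a a′ (S-mono c⊑e a Sca) (S-mono c′⊑e a′ Sc′a′)
      in z , (e , Ie , Sez) , a⊑z , a′⊑z

module DCPOProperties (D : DCPO) where
  open DCPO D

  infix 4 _≪ᴰ_
  _≪ᴰ_ : Carrier → Carrier → Set₁
  _≪ᴰ_ = _≪_ D

  ≪-⊑-trans : ∀ {x y z} → x ≪ᴰ y → y ⊑ z → x ≪ᴰ z
  ≪-⊑-trans x≪y y⊑z S d z⊑∐ = x≪y S d (⊑-trans y⊑z z⊑∐)

  ⊑-≪-trans : ∀ {x y z} → x ⊑ y → y ≪ᴰ z → x ≪ᴰ z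
  ⊑-≪-trans x⊑y y≪z S d z⊑∐ =
    let (s , Ss , y⊑s) = y≪z S d z⊑∐ in s , Ss , ⊑-trans x⊑y y⊑s

  singleton-directed : ∀ y → IsDirected poset (_≡ y)
  singleton-directed y = (y , refl) , λ { _ _ refl refl → y , refl , ⊑-refl , ⊑-refl }

  ≪⇒⊑ : ∀ {x y} → x ≪ᴰ y → x ⊑ y
  ≪⇒⊑ {y = y} x≪y
    with x≪y (_≡ y) (singleton-directed y) (proj₁ (∐-isSup _ (singleton-directed y)) y refl)
  ... | _ , refl , x⊑y = x⊑y

  isScottOpen⇒↟⊆ : ∀ {ℓ} {U : Carrier → Set ℓ} {b} → IsScottOpen D U → U b → ↟ D b ⊆′ U
  isScottOpen⇒↟⊆ (U-up , _) Ub z b≪z = U-up _ z (≪⇒⊑ b≪z) Ub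

  StableOn DecidableOn : ∀ {ℓ} → (Carrier → Set) → (Carrier → Carrier → Set ℓ) → Set ℓ
  StableOn B _R_ = ∀ a b → B a → B b → Stable (a R b)
  DecidableOn B _R_ = ∀ a b → B a → B b → Decidable (a R b)

  decidable⇒stable : ∀ {ℓ} {A : Set ℓ} → Decidable A → Stable A
  decidable⇒stable (inj₁ a) _ = a
  decidable⇒stable (inj₂ ¬a) ¬¬a = contradiction ¬a ¬¬a

  decidableOn⇒stableOn : ∀ {ℓ} {B} {R : Carrier → Carrier → Set ℓ} →
    DecidableOn B R → StableOn B R
  decidableOn⇒stableOn dec a b a∈B b∈B = decidable⇒stable (dec a b a∈B b∈B)

  ¬¬≪⇒⊑On : (Carrier → Set) → Set₁
  ¬¬≪⇒⊑On B = ∀ a b → B a → B b → ¬ ¬ (a ≪ᴰ b) → a ⊑ b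

  stability⇒¬¬≪⇒⊑ : ∀ {B} →
    StableOn B _≪ᴰ_ ⊎ StableOn B _⊑_ ⊎ DecidableOn B _≪ᴰ_ ⊎ DecidableOn B _⊑_ →
    ¬¬≪⇒⊑On B
  stability⇒¬¬≪⇒⊑ {B} =
    [ ≪-stable , [ ⊑-stable , [ ≪-stable ∘ decidableOn⇒stableOn
                              , ⊑-stable ∘ decidableOn⇒stableOn ] ] ]
    where
    ≪-stable : StableOn B _≪ᴰ_ → ¬¬≪⇒⊑On B
    ≪-stable stable a b a∈B b∈B = ≪⇒⊑ ∘ stable a b a∈B b∈B

    ⊑-stable : StableOn B _⊑_ → ¬¬≪⇒⊑On B
    ⊑-stable stable a b a∈B b∈B = stable a b a∈B b∈B ∘ ¬¬-map ≪⇒⊑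

  interior-mono : ∀ {ℓ ℓ′} {Y : Carrier → Set ℓ} {Z : Carrier → Set ℓ′} →
    Y ⊆′ Z → interior D Y ⊆′ interior D Z
  interior-mono Y⊆Z x (V , V-open , Vx , V⊆Y) = V , V-open , Vx , λ z → Y⊆Z z ∘ V⊆Y z

  isScottOpen⇒⊆interior : ∀ {ℓ} {V : Carrier → Set₁} {Y : Carrier → Set ℓ} →
    IsScottOpen D V → V ⊆′ Y → V ⊆′ interior D Y
  isScottOpen⇒⊆interior V-open V⊆Y x Vx = _ , V-open , Vx , V⊆Y

  ⊆interior⇒isScottOpen : ∀ {ℓ} {U : Carrier → Set ℓ} →
    U ⊆′ interior D U → IsScottOpen D U
  ⊆interior⇒isScottOpen {U = U} U⊆U° = U-up , U-inaccessible
    where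
    U-up : ∀ x y → x ⊑ y → U x → U y
    U-up x y x⊑y Ux =
      let (V , (V-up , _) , Vx , V⊆U) = U⊆U° x Ux in V⊆U y (V-up x y x⊑y Vx)

    U-inaccessible : (S : Carrier → Set) (d : IsDirected poset S) →
      U (∐ S d) → Σ[ s ∈ Carrier ] S s × U s
    U-inaccessible S d U∐ =
      let (V , (_ , V-inaccessible) , V∐ , V⊆U) = U⊆U° _ U∐
          (s , Ss , Vs) = V-inaccessible S d V∐
      in s , Ss , V⊆U s Vs

  ≰S-irrefl : ∀ x → ¬ (_≰S_ D x x)
  ≰S-irrefl x (_ , _ , Ux , ¬Ux) = ¬Ux Ux

  #-irrefl : ∀ x → ¬ (_#_ D x x)
  #-irrefl x = [ ≰S-irrefl x , ≰S-irrefl x ]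

  notNotStable⇒≐apartComp∁ : {V : Carrier → Set₁} → IsScottOpen D V →
    interior D (λ y → ¬ ¬ V y) ⊆′ V → V ≐′ apartComp D (∁ V)
  notNotStable⇒≐apartComp∁ {V} V-open V-stable =
    isScottOpen⇒⊆interior V-open (λ x Vx y ¬Vy → inj₁ (V , V-open , Vx , ¬Vy)) ,
    λ x → V-stable x ∘ interior-mono ∼∁V⊆¬¬V x
    where
    ∼∁V⊆¬¬V : ∼ D (∁ V) ⊆′ (λ y → ¬ ¬ V y)
    ∼∁V⊆¬¬V x x#∁V ¬Vx = #-irrefl x (x#∁V x ¬Vx)

  isApartnessOpen⇒isScottOpen : {U : Carrier → Set₁} → IsApartnessOpen D U → IsScottOpen D U
  isApartnessOpen⇒isScottOpen U-open = ⊆interior⇒isScottOpen λ x Ux →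
    let (A , (V , V-open , Vx , V⊆∼A) , -A⊆U) = U-open x Ux
    in V , V-open , Vx , λ z → -A⊆U z ∘ isScottOpen⇒⊆interior V-open V⊆∼A z

  notNotStableScottBasis⇒scottOpen↔apartnessOpen : ∀ {I} {W : I → Carrier → Set₁} →
    IsNotNotStableScottBasis D W → (U : Carrier → Set₁) →
    IsScottOpen D U ↔ IsApartnessOpen D U
  notNotStableScottBasis⇒scottOpen↔apartnessOpen {W = W} ((W-open , W-covers) , W-stable) U =
    isScottOpen⇒isApartnessOpen , isApartnessOpen⇒isScottOpen
    where
    isScottOpen⇒isApartnessOpen : IsScottOpen D U → IsApartnessOpen D U
    isScottOpen⇒isApartnessOpen U-open x Ux =
      let (i , Wix , Wi⊆U) = W-covers U U-open x Ux
          (Wi⊆-∁Wi , -∁Wi⊆Wi) =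
            notNotStable⇒≐apartComp∁ (W-open i) (λ z → proj₂ (W-stable i z))
      in ∁ (W i) , Wi⊆-∁Wi x Wix , λ z → Wi⊆U z ∘ -∁Wi⊆Wi z

module ContinuousBasis (D : DCPO) (B : DCPO.Carrier D → Set)
                       (basis : IsBasis D B) (small : WayBelowSmallOnBasis D B) where
  open DCPO D
  open DCPOProperties D
  open PosetProperties poset

  -- {b ∈ B | b ≪ x}, resized along small so that it is a (Set-valued) directed subset.
  ↡ᴮ : Carrier → Carrier → Set
  ↡ᴮ x b = Σ[ b∈B ∈ B b ] proj₁ (small b x b∈B)

  ↡ᴮ⇒≪ : ∀ {x b} → ↡ᴮ x b → b ≪ᴰ x
  ↡ᴮ⇒≪ {x} {b} (b∈B , p) = proj₁ (proj₂ (small b x b∈B)) p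

  ≪⇒↡ᴮ : ∀ {x b} → B b → b ≪ᴰ x → ↡ᴮ x b
  ≪⇒↡ᴮ {x} {b} b∈B b≪x = b∈B , proj₂ (proj₂ (small b x b∈B)) b≪x

  ↡ᴮ-directed : ∀ x → IsDirected poset (↡ᴮ x)
  ↡ᴮ-directed x = isDirected-resp-≐′
    ((λ b (b∈B , b≪x) → ≪⇒↡ᴮ b∈B b≪x) , (λ b x↡b → proj₁ x↡b , ↡ᴮ⇒≪ x↡b))
    (proj₁ (basis x))

  ↡ᴮ-least : ∀ {x u} → IsUpperBound poset (↡ᴮ x) u → x ⊑ u
  ↡ᴮ-least {x} {u} ub = proj₂ (proj₂ (basis x)) u λ b (b∈B , b≪x) → ub b (≪⇒↡ᴮ b∈B b≪x)

  ⊑∐↡ᴮ : ∀ x → x ⊑ ∐ (↡ᴮ x) (↡ᴮ-directed x)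
  ⊑∐↡ᴮ x = ↡ᴮ-least (proj₁ (∐-isSup _ (↡ᴮ-directed x)))

  ↡ᴮ-mono : ∀ {x y} → x ⊑ y → ↡ᴮ x ⊆′ ↡ᴮ y
  ↡ᴮ-mono x⊑y b x↡b = ≪⇒↡ᴮ (proj₁ x↡b) (≪-⊑-trans (↡ᴮ⇒≪ x↡b) x⊑y)

  ↡ᴮ² : Carrier → Carrier → Set
  ↡ᴮ² y a = Σ[ c ∈ Carrier ] ↡ᴮ y c × ↡ᴮ c a

  ↡ᴮ²-directed : ∀ y → IsDirected poset (↡ᴮ² y)
  ↡ᴮ²-directed y = ⋃-directed (↡ᴮ-directed y) (λ c _ → ↡ᴮ-directed c) ↡ᴮ-mono

  ↡ᴮ²-least : ∀ {y u} → IsUpperBound poset (↡ᴮ² y) u → y ⊑ u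
  ↡ᴮ²-least ub = ↡ᴮ-least λ c y↡c → ↡ᴮ-least λ a c↡a → ub a (c , y↡c , c↡a)

  -- y is the supremum of the directed set ↡ᴮ² y, so x ≪ y lies below some a ≪ c ≪ y.
  ≪-interpolate : ∀ {x y} → x ≪ᴰ y → Σ[ c ∈ Carrier ] B c × x ≪ᴰ c × c ≪ᴰ y
  ≪-interpolate {y = y} x≪y =
    let (a , (c , y↡c , c↡a) , x⊑a) =
          x≪y (↡ᴮ² y) (↡ᴮ²-directed y) (↡ᴮ²-least (proj₁ (∐-isSup _ (↡ᴮ²-directed y))))
    in c , proj₁ y↡c , ⊑-≪-trans x⊑a (↡ᴮ⇒≪ c↡a) , ↡ᴮ⇒≪ y↡c

  ↟-isScottOpen : ∀ b → IsScottOpen D (↟ D b)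
  ↟-isScottOpen b =
    (λ x y x⊑y b≪x → ≪-⊑-trans b≪x x⊑y) ,
    λ S d b≪∐ →
      let (c , _ , b≪c , c≪∐) = ≪-interpolate b≪∐
          (s , Ss , c⊑s) = c≪∐ S d ⊑-refl
      in s , Ss , ≪-⊑-trans b≪c c⊑s

  isScottOpen-approximate : ∀ {ℓ} {U : Carrier → Set ℓ} {x} → IsScottOpen D U → U x →
    Σ[ c ∈ Carrier ] B c × c ≪ᴰ x × U c
  isScottOpen-approximate {x = x} (U-up , U-inaccessible) Ux =
    let (c , x↡c , Uc) = U-inaccessible (↡ᴮ x) (↡ᴮ-directed x) (U-up x _ (⊑∐↡ᴮ x) Ux)
    in c , proj₁ x↡c , ↡ᴮ⇒≪ x↡c , Uc

  ↟-isScottTopologyBasis : IsScottTopologyBasis D {Σ Carrier B} (λ b → ↟ D (proj₁ b))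
  ↟-isScottTopologyBasis =
    (λ b → ↟-isScottOpen (proj₁ b)) ,
    λ U U-open x Ux →
      let (c , c∈B , c≪x , Uc) = isScottOpen-approximate U-open Ux
      in (c , c∈B) , c≪x , isScottOpen⇒↟⊆ U-open Uc

  ↟-isNotNotStable : ¬¬≪⇒⊑On B → IsNotNotStableFamily D {Σ Carrier B} (λ b → ↟ D (proj₁ b))
  ↟-isNotNotStable ¬¬≪⇒⊑ (b , b∈B) x =
    isScottOpen⇒⊆interior (↟-isScottOpen b) (λ _ → contradiction) x ,
    λ (V , V-open , Vx , V⊆¬¬↟b) →
      let (c , c∈B , c≪x , Vc) = isScottOpen-approximate V-open Vx
      in ⊑-≪-trans (¬¬≪⇒⊑ b c b∈B c∈B (V⊆¬¬↟b c Vc)) c≪x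

theorem4p8 : (D : DCPO) (B : DCPO.Carrier D → Set) →
    IsBasis D B → WayBelowSmallOnBasis D B →
    ((∀ a b → B a → B b → ¬ ¬ (_≪_ D a b) → _≪_ D a b)
     ⊎ (∀ a b → B a → B b → ¬ ¬ (DCPO._⊑_ D a b) → DCPO._⊑_ D a b)
     ⊎ (∀ a b → B a → B b → Decidable (_≪_ D a b))
     ⊎ (∀ a b → B a → B b → Decidable (DCPO._⊑_ D a b))) →
    IsNotNotStableScottBasis D {Σ (DCPO.Carrier D) B} (λ b → ↟ D (proj₁ b))
    × ((U : DCPO.Carrier D → Set₁) → IsScottOpen D U ↔ IsApartnessOpen D U)
theorem4p8 D B basis small condition =
  ↟-notNotStableScottBasis ,
  notNotStableScottBasis⇒scottOpen↔apartnessOpen ↟-notNotStableScottBasis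
  where
  open DCPOProperties D
  open ContinuousBasis D B basis small

  ↟-notNotStableScottBasis : IsNotNotStableScottBasis D {Σ (DCPO.Carrier D) B} (λ b → ↟ D (proj₁ b))
  ↟-notNotStableScottBasis =
    ↟-isScottTopologyBasis , ↟-isNotNotStable (stability⇒¬¬≪⇒⊑ condition)
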